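{- Consider the online flow-time-plus-switching-cost problem with linear switching cost $c(s(t),s(t-1))=|s(t)-s(t-1)|$ and weight $0<\alpha\le 1$. The online algorithm $\mathcal{A}_f$ that in every slot $t$ chooses $s(t)=n(t)$ (as many active servers as outstanding jobs) is $2$-competitive, and this competitive ratio is tight: there exist $\alpha\le 1$ and inputs on which the ratio of the cost of $\mathcal{A}_f$ to the cost of $\mathsf{OPT}$ is arbitrarily close to $2$.
   Context: Time is slotted, $t=1,2,\dots$. A finite set $\mathcal{J}$ of jobs arrives over time; job $j$ arrives at the start of slot $a_j$ and has size (work) $w_j\in\mathbb{Z}^+$, revealed on arrival; all job sizes are identical, equal to some $w$. There is an unlimited number of identical servers of speed $1$ (one unit of work per slot); in any slot each server processes at most one job and each job is processed by at most one server (preemption and migration allowed). A job departs once its total processed work equals its size. An algorithm chooses a number $s(t)\in\mathbb{Z}_{\ge 0}$ of active servers in each slot, with $s(0)=0$, subject to work neutrality $\sum_{\tau\le t}s(\tau)\le\sum_{\tau\le t}w(\tau)$ for all $t$, where $w(\tau)$ is the total size of the jobs arriving at slot $\tau$. Let $n(t)$ be the number of outstanding jobs at slot $t$ (so the total flow time equals $\sum_t n(t)$). The cost of an algorithm is $\sum_t n(t)+\alpha\sum_t c(s(t),s(t-1))$. An online algorithm decides $s(t)$ knowing only the jobs that arrived up to slot $t$ (not even $|\mathcal{J}|$). $\mathsf{OPT}$ is the optimal offline algorithm that knows the whole input in advance. The competitive ratio of $\mathcal{A}$ is $\sup_\sigma C_{\mathcal{A}}(\sigma)/C_{\mathsf{OPT}}(\sigma)$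 over all inputs $\sigma$; $\mathcal{A}$ is $c$-competitive if this is at most $c$. -}

module Defs where

open import Data.Nat using (ℕ; zero; suc; _+_; _*_; _∸_; _≤_; _<_; _≤ᵇ_; _<ᵇ_; ∣_-_∣; _⊔_)
open import Data.Bool using (Bool; true; false; _∧_; if_then_else_)
open import Data.Fin using (Fin; zero; suc)
open import Data.Integer using (+_)
open import Data.Rational using (ℚ; _/_) renaming (_+_ to _+ℚ_; _*_ to _*ℚ_)
open import Relation.Binary.PropositionalEquality using (_≡_)

toℚ : ℕ → ℚ
toℚ n = (+ n) / 1

sumFin : (m : ℕ) → (Fin m → ℕ) → ℕ
sumFin zero    f = 0
sumFin (suc m) f = f zero + sumFin m (λ j → f (suc j))

maxFin : (m : ℕ) → (Fin m → ℕ) → ℕ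
maxFin zero    f = 0
maxFin (suc m) f = f zero ⊔ maxFin m (λ j → f (suc j))

-- Σ_{t=1}^{T} f t
sumTo : ℕ → (ℕ → ℕ) → ℕ
sumTo zero    f = 0
sumTo (suc T) f = sumTo T f + f (suc T)

bit : Bool → ℕ
bit true  = 1
bit false = 0

-- The model for a fixed input: m jobs, job j arrives at the start of slot
-- a j (≥ 1), all jobs have the same size w (≥ 1).
module Model (m : ℕ) (a : Fin m → ℕ) (w : ℕ) where

  -- a processing pattern: p t j = true iff job j is processed (by some
  -- server, one unit of work) in slot t
  Pattern : Set
  Pattern = ℕ → Fin m → Bool

  work : Pattern → ℕ → Fin m → ℕ
  work p t j = sumTo t (λ τ → bit (p τ j))

  outstanding : Pattern → ℕ → Fin m → Bool
  outstanding p t j = (a j ≤ᵇ t) ∧ (work p (t ∸ 1) j <ᵇ w)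

  nOut : Pattern → ℕ → ℕ
  nOut p t = sumFin m (λ j → bit (outstanding p t j))

  -- w(τ): total size of jobs arriving at slot τ
  arrivingWork : ℕ → ℕ
  arrivingWork τ = w * sumFin m (λ j → bit ((a j ≤ᵇ τ) ∧ (τ ≤ᵇ a j)))

  -- cost over horizon T (all jobs finished and s = 0 after slot T):
  -- Σ_{t=1}^{T} n(t) + α Σ_{t=1}^{T+1} |s(t) − s(t−1)|
  costOf : ℚ → ℕ → (ℕ → ℕ) → Pattern → ℚ
  costOf α T s p =
    toℚ (sumTo T (nOut p)) +ℚ (α *ℚ toℚ (sumTo (suc T) (λ t → ∣ s t - s (t ∸ 1) ∣)))

  record Schedule : Set where
    field
      T        : ℕ
      s        : ℕ → ℕ
      p        : Pattern
      s0       : s 0 ≡ 0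
      sAfter   : ∀ t → T < t → s t ≡ 0
      valid    : ∀ t j → p t j ≡ true → outstanding p t j ≡ true
      capacity : ∀ t → sumFin m (λ j → bit (p t j)) ≤ s t
      neutral  : ∀ t → sumTo t s ≤ sumTo t arrivingWork
      complete : ∀ j → work p T j ≡ w

  cost : ℚ → Schedule → ℚ
  cost α S = costOf α (Schedule.T S) (Schedule.s S) (Schedule.p S)

  -- The online algorithm A_f: s(t) = n(t); every outstanding job is processed.
  -- afWork t j = work done on job j in slots 1..t
  afWork : ℕ → Fin m → ℕ
  afWork zero    j = 0
  afWork (suc t) j = afWork t j + bit ((a j ≤ᵇ suc t) ∧ (afWork t j <ᵇ w))

  afP : Pattern
  afP zero    j = false
  afP (suc t) j = (a j ≤ᵇ suc t) ∧ (afWork t j <ᵇ w)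

  afS : ℕ → ℕ
  afS = nOut afP

  -- a horizon after which A_f has finished all jobs and s = 0
  afHorizon : ℕ
  afHorizon = maxFin m a + w

  costAf : ℚ → ℚ
  costAf α = costOf α afHorizon afS afP

-- Work neutrality forces a feasible schedule S to keep exactly as many servers active as it
-- processes jobs, while A_f keeps job j outstanding during exactly the w slots from a_j on; so
-- A_f has flow time m w and switching cost at most 2m.  As A_f is greedy, a job outstanding
-- under A_f is outstanding under S.  With x, y, z the indicators of being outstanding under
-- A_f, processed by S and outstanding under S, this gives |x - y| + x + y ≤ 2z, and summing,
-- D + 2 m w ≤ 2F for the total mismatch D = Σ |x - y| and the flow time F of S.  The triangle
-- inequality through S bounds the switching cost of A_f by V + 2D, V that of S; averaging
-- with the bound 2m ≤ 2 m w gives m w + (switching cost of A_f) ≤ 2F + V, and interpolating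
-- in α gives the ratio 2.
-- For tightness, k pairs of unit jobs arrive in slots 1, 3, ..., 2k - 1: with α = 1, A_f pays
-- 2k + 4k, while serving one job of each pair a slot late costs 3k + 2.

module Submission where

open import Defs
open import Data.Nat using (ℕ; _≤_)
open import Data.Fin using (Fin)

module Summation where

  open import Data.Nat
  open import Data.Nat.Properties
  open import Data.Fin using (zero; suc)
  open import Data.Sum using (inj₁; inj₂)
  open import Relation.Binary.PropositionalEquality
  open import Algebra.Properties.CommutativeSemigroup +-commutativeSemigroup using (interchange)

  sumTo-cong : ∀ T {f g : ℕ → ℕ} → (∀ t → f (suc t) ≡ g (suc t)) → sumTo T f ≡ sumTo T g
  sumTo-cong zero    f≗g = refl
  sumTo-cong (suc T) f≗g = cong₂ _+_ (sumTo-cong T f≗g) (f≗g T)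

  sumTo-monoʳ-≤ : ∀ T {f g : ℕ → ℕ} → (∀ t → f (suc t) ≤ g (suc t)) → sumTo T f ≤ sumTo T g
  sumTo-monoʳ-≤ zero    f≤g = z≤n
  sumTo-monoʳ-≤ (suc T) f≤g = +-mono-≤ (sumTo-monoʳ-≤ T f≤g) (f≤g T)

  sumTo-monoˡ-≤ : ∀ {T N} f → T ≤ N → sumTo T f ≤ sumTo N f
  sumTo-monoˡ-≤ {N = zero}  f z≤n = ≤-refl
  sumTo-monoˡ-≤ {N = suc N} f T≤1+N with m≤n⇒m<n∨m≡n T≤1+N
  ... | inj₂ refl       = ≤-refl
  ... | inj₁ (s≤s T≤N) = ≤-trans (sumTo-monoˡ-≤ f T≤N) (m≤m+n _ _)

  sumTo-distrib-+ : ∀ T f g → sumTo T (λ t → f t + g t) ≡ sumTo T f + sumTo T g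
  sumTo-distrib-+ zero    f g = refl
  sumTo-distrib-+ (suc T) f g rewrite sumTo-distrib-+ T f g =
    interchange (sumTo T f) (sumTo T g) (f (suc T)) (g (suc T))

  sumTo-distribˡ-* : ∀ T c f → sumTo T (λ t → c * f t) ≡ c * sumTo T f
  sumTo-distribˡ-* zero    c f = sym (*-zeroʳ c)
  sumTo-distribˡ-* (suc T) c f rewrite sumTo-distribˡ-* T c f = sym (*-distribˡ-+ c (sumTo T f) (f (suc T)))

  sumTo-zero-tail : ∀ {T} N f → (∀ t → T < t → f t ≡ 0) → T ≤ N → sumTo N f ≡ sumTo T f
  sumTo-zero-tail zero    f vanish z≤n = refl
  sumTo-zero-tail (suc N) f vanish T≤1+N with m≤n⇒m<n∨m≡n T≤1+N
  ... | inj₂ refl       = refl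
  ... | inj₁ (s≤s T≤N) rewrite sumTo-zero-tail N f vanish T≤N | vanish (suc N) (s≤s T≤N) = +-identityʳ _

  sumTo-pred : ∀ N g → sumTo N (λ t → g (t ∸ 1)) + g N ≡ g 0 + sumTo N g
  sumTo-pred zero    g = sym (+-identityʳ (g 0))
  sumTo-pred (suc N) g = begin
    sumTo N (λ t → g (t ∸ 1)) + g N + g (suc N)  ≡⟨ cong (_+ g (suc N)) (sumTo-pred N g) ⟩
    g 0 + sumTo N g + g (suc N)                  ≡⟨ +-assoc (g 0) _ _ ⟩
    g 0 + (sumTo N g + g (suc N))                ∎
    where open ≡-Reasoning

  sumTo-pred-≤ : ∀ N g → g 0 ≡ 0 → sumTo N (λ t → g (t ∸ 1)) ≤ sumTo N g
  sumTo-pred-≤ N g g0≡0 = begin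
    sumTo N (λ t → g (t ∸ 1))        ≤⟨ m≤m+n _ (g N) ⟩
    sumTo N (λ t → g (t ∸ 1)) + g N  ≡⟨ sumTo-pred N g ⟩
    g 0 + sumTo N g                  ≡⟨ cong (_+ sumTo N g) g0≡0 ⟩
    sumTo N g                        ∎
    where open ≤-Reasoning

  sumTo-squeeze : ∀ T {f g : ℕ → ℕ} → (∀ t → f (suc t) ≤ g (suc t)) → sumTo T g ≤ sumTo T f →
                  ∀ t → t < T → f (suc t) ≡ g (suc t)
  sumTo-squeeze (suc T) {f} {g} f≤g Σg≤Σf t t<1+T with m≤n⇒m<n∨m≡n (≤-pred t<1+T)
  ... | inj₁ t<T  = sumTo-squeeze T f≤g Σg≤Σf-up-to-T t t<T
    where
    Σg≤Σf-up-to-T : sumTo T g ≤ sumTo T f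
    Σg≤Σf-up-to-T = +-cancelʳ-≤ (g (suc T)) _ _ (≤-trans Σg≤Σf (+-monoʳ-≤ (sumTo T f) (f≤g T)))
  ... | inj₂ refl = ≤-antisym (f≤g t)
    (+-cancelˡ-≤ (sumTo t g) _ _ (≤-trans Σg≤Σf (+-monoˡ-≤ (f (suc t)) (sumTo-monoʳ-≤ t f≤g))))

  sumFin-cong : ∀ m {f g : Fin m → ℕ} → (∀ j → f j ≡ g j) → sumFin m f ≡ sumFin m g
  sumFin-cong zero    f≗g = refl
  sumFin-cong (suc m) f≗g = cong₂ _+_ (f≗g zero) (sumFin-cong m (λ j → f≗g (suc j)))

  sumFin-mono-≤ : ∀ m {f g : Fin m → ℕ} → (∀ j → f j ≤ g j) → sumFin m f ≤ sumFin m g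
  sumFin-mono-≤ zero    f≤g = z≤n
  sumFin-mono-≤ (suc m) f≤g = +-mono-≤ (f≤g zero) (sumFin-mono-≤ m (λ j → f≤g (suc j)))

  sumFin-distrib-+ : ∀ m (f g : Fin m → ℕ) → sumFin m (λ j → f j + g j) ≡ sumFin m f + sumFin m g
  sumFin-distrib-+ zero    f g = refl
  sumFin-distrib-+ (suc m) f g rewrite sumFin-distrib-+ m (λ j → f (suc j)) (λ j → g (suc j)) =
    interchange (f zero) (g zero) (sumFin m (λ j → f (suc j))) (sumFin m (λ j → g (suc j)))

  sumFin-const : ∀ m c → sumFin m (λ _ → c) ≡ m * c
  sumFin-const zero    c = refl
  sumFin-const (suc m) c = cong (c +_) (sumFin-const m c)

  sumFin-zero : ∀ m (f : Fin m → ℕ) → (∀ j → f j ≡ 0) → sumFin m f ≡ 0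
  sumFin-zero m f f≗0 = trans (sumFin-cong m f≗0) (trans (sumFin-const m 0) (*-zeroʳ m))

  term≤maxFin : ∀ m (f : Fin m → ℕ) j → f j ≤ maxFin m f
  term≤maxFin (suc m) f zero    = m≤m⊔n _ _
  term≤maxFin (suc m) f (suc j) = ≤-trans (term≤maxFin m (λ i → f (suc i)) j) (m≤n⊔m _ _)

  sumTo-sumFin-comm : ∀ T m (f : ℕ → Fin m → ℕ) →
    sumTo T (λ t → sumFin m (f t)) ≡ sumFin m (λ j → sumTo T (λ t → f t j))
  sumTo-sumFin-comm zero    m f = sym (sumFin-zero m _ (λ _ → refl))
  sumTo-sumFin-comm (suc T) m f rewrite sumTo-sumFin-comm T m f =
    sym (sumFin-distrib-+ m (λ j → sumTo T (λ t → f t j)) (f (suc T)))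

module Indicators where

  open import Data.Nat
  open import Data.Nat.Properties
  open import Data.Bool using (true; false; _∧_)
  open import Data.Bool.Properties using (T-≡; ∧-zeroʳ)
  open import Data.Product using (_×_; _,_)
  open import Relation.Binary.Definitions using (tri<; tri≈; tri>)
  open import Function.Bundles using (Equivalence)
  open import Relation.Binary.PropositionalEquality
  open import Relation.Nullary using (yes; no; contradiction)
  open Summation

  ≤ᵇ-true : ∀ {m n} → m ≤ n → (m ≤ᵇ n) ≡ true
  ≤ᵇ-true m≤n = Equivalence.to T-≡ (≤⇒≤ᵇ m≤n)

  ≤ᵇ-true⁻¹ : ∀ {m n} → (m ≤ᵇ n) ≡ true → m ≤ n
  ≤ᵇ-true⁻¹ {m} {n} eq = ≤ᵇ⇒≤ m n (Equivalence.from T-≡ eq)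

  ≤ᵇ-false : ∀ {m n} → n < m → (m ≤ᵇ n) ≡ false
  ≤ᵇ-false {m} {n} n<m with m ≤ᵇ n in eq
  ... | false = refl
  ... | true  = contradiction (≤ᵇ-true⁻¹ eq) (<⇒≱ n<m)

  <ᵇ-true : ∀ {m n} → m < n → (m <ᵇ n) ≡ true
  <ᵇ-true m<n = Equivalence.to T-≡ (<⇒<ᵇ m<n)

  <ᵇ-true⁻¹ : ∀ {m n} → (m <ᵇ n) ≡ true → m < n
  <ᵇ-true⁻¹ {m} {n} eq = <ᵇ⇒< m n (Equivalence.from T-≡ eq)

  <ᵇ-false : ∀ {m n} → n ≤ m → (m <ᵇ n) ≡ false
  <ᵇ-false {m} {n} n≤m with m <ᵇ n in eq
  ... | false = refl
  ... | true  = contradiction (<ᵇ-true⁻¹ eq) (≤⇒≯ n≤m)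

  suc-≤ᵇ-suc : ∀ m n → (suc m ≤ᵇ suc n) ≡ (m ≤ᵇ n)
  suc-≤ᵇ-suc zero    n = refl
  suc-≤ᵇ-suc (suc m) n = refl

  ∧-true⁻¹ : ∀ {x y} → x ∧ y ≡ true → x ≡ true × y ≡ true
  ∧-true⁻¹ {true} {true} refl = refl , refl

  bit≤1 : ∀ b → bit b ≤ 1
  bit≤1 true  = ≤-refl
  bit≤1 false = z≤n

  bit-mismatch-≤ : ∀ x y z → (x ≡ true → z ≡ true) → (y ≡ true → z ≡ true) →
                   ∣ bit x - bit y ∣ + (bit x + bit y) ≤ bit z + bit z
  bit-mismatch-≤ true  true  z x⇒z _   rewrite x⇒z refl = ≤-refl
  bit-mismatch-≤ true  false z x⇒z _   rewrite x⇒z refl = ≤-refl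
  bit-mismatch-≤ false true  z _   y⇒z rewrite y⇒z refl = ≤-refl
  bit-mismatch-≤ false false z _   _   = z≤n

  step : ℕ → ℕ → ℕ
  step c t = bit (c ≤ᵇ t)

  pulse : ℕ → ℕ → ℕ
  pulse c t = bit ((c ≤ᵇ t) ∧ (t ≤ᵇ c))

  -- x is the indicator function of the slots t with c ≤ t < d (when c ≤ d).
  record IntervalIndicator (c d : ℕ) (x : ℕ → ℕ) : Set where
    field
      split : ∀ t → x t + step d t ≡ step c t

  open IntervalIndicator public

  step-mono : ∀ c t → step c t ≤ step c (suc t)
  step-mono c t with c ≤ᵇ t in eq
  ... | false = z≤n
  ... | true  rewrite ≤ᵇ-true (m≤n⇒m≤1+n (≤ᵇ-true⁻¹ {c} {t} eq)) = ≤-refl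

  step-antimono : ∀ {c d} t → c ≤ d → step d t ≤ step c t
  step-antimono {c} {d} t c≤d with d ≤ᵇ t in eq
  ... | false = z≤n
  ... | true  rewrite ≤ᵇ-true (≤-trans c≤d (≤ᵇ-true⁻¹ {d} {t} eq)) = ≤-refl

  pulse-≢ : ∀ {c t} → c ≢ t → pulse c t ≡ 0
  pulse-≢ {c} {t} c≢t with <-cmp c t
  ... | tri< c<t _ _ rewrite ≤ᵇ-false c<t = cong bit (∧-zeroʳ (c ≤ᵇ t))
  ... | tri≈ _ c≡t _ = contradiction c≡t c≢t
  ... | tri> _ _ t<c rewrite ≤ᵇ-false t<c = refl

  pulse-self : ∀ c → pulse c c ≡ 1
  pulse-self c rewrite ≤ᵇ-true (≤-refl {c}) = refl

  pulse-interval : ∀ c → IntervalIndicator c (suc c) (pulse c)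
  pulse-interval zero    .split zero    = refl
  pulse-interval zero    .split (suc t) = refl
  pulse-interval (suc c) .split zero    = refl
  pulse-interval (suc c) .split (suc t)
    rewrite suc-≤ᵇ-suc c t | suc-≤ᵇ-suc (suc c) t | suc-≤ᵇ-suc t c = pulse-interval c .split t

  interval-unique : ∀ {c d x y} → IntervalIndicator c d x → IntervalIndicator c d y → ∀ t → x t ≡ y t
  interval-unique {d = d} x-ind y-ind t = +-cancelʳ-≡ (step d t) _ _ (trans (x-ind .split t) (sym (y-ind .split t)))

  sumTo-pulse : ∀ c t → 1 ≤ c → sumTo t (pulse c) ≡ step c t
  sumTo-pulse (suc c) zero    _   = refl
  sumTo-pulse c       (suc t) 1≤c = begin
    sumTo t (pulse c) + pulse c (suc t)       ≡⟨ cong (_+ pulse c (suc t)) (sumTo-pulse c t 1≤c) ⟩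
    step c t + pulse c (suc t)                ≡⟨ +-comm (step c t) _ ⟩
    pulse c (suc t) + step c t                ≡⟨ cong (λ b → pulse c (suc t) + bit b) (suc-≤ᵇ-suc c t) ⟨
    pulse c (suc t) + step (suc c) (suc t)    ≡⟨ pulse-interval c .split (suc t) ⟩
    step c (suc t)                            ∎
    where open ≡-Reasoning

  sumTo-step : ∀ c N → 1 ≤ c → sumTo N (step c) ≡ suc N ∸ c
  sumTo-step (suc c) zero    _   = sym (0∸n≡0 c)
  sumTo-step c       (suc N) 1≤c rewrite sumTo-step c N 1≤c with c ≤? suc N
  ... | yes c≤1+N rewrite ≤ᵇ-true c≤1+N = trans (+-comm (suc N ∸ c) 1) (sym (+-∸-assoc 1 c≤1+N))
  ... | no  c≰1+N rewrite ≤ᵇ-false (≰⇒> c≰1+N) | m≤n⇒m∸n≡0 (≰⇒> c≰1+N)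
                        | m≤n⇒m∸n≡0 (≤-trans (n≤1+n (suc N)) (≰⇒> c≰1+N)) = refl

  sumTo-interval : ∀ {c d x} N → IntervalIndicator c d x → 1 ≤ c → c ≤ d → d ≤ suc N → sumTo N x ≡ d ∸ c
  sumTo-interval {c} {d} {x} N x-ind 1≤c c≤d d≤1+N = +-cancelʳ-≡ (suc N ∸ d) _ _ (begin
    sumTo N x + (suc N ∸ d)           ≡⟨ cong (sumTo N x +_) (sumTo-step d N (≤-trans 1≤c c≤d)) ⟨
    sumTo N x + sumTo N (step d)      ≡⟨ sumTo-distrib-+ N x (step d) ⟨
    sumTo N (λ t → x t + step d t)    ≡⟨ sumTo-cong N (λ t → x-ind .split (suc t)) ⟩
    sumTo N (step c)                  ≡⟨ sumTo-step c N 1≤c ⟩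
    suc N ∸ c                         ≡⟨ cong (_∸ c) (m∸n+n≡m d≤1+N) ⟨
    (suc N ∸ d) + d ∸ c               ≡⟨ +-∸-assoc (suc N ∸ d) c≤d ⟩
    (suc N ∸ d) + (d ∸ c)             ≡⟨ +-comm (suc N ∸ d) (d ∸ c) ⟩
    (d ∸ c) + (suc N ∸ d)             ∎)
    where open ≡-Reasoning

module Variation where

  open import Data.Nat
  open import Data.Nat.Properties
  open import Data.Fin using (zero; suc)
  open import Relation.Binary.PropositionalEquality
  open import Data.Nat.Solver using (module +-*-Solver)
  open +-*-Solver
  open Summation
  open Indicators

  variation : ℕ → (ℕ → ℕ) → ℕ
  variation N g = sumTo N (λ t → ∣ g t - g (t ∸ 1) ∣)

  ∣m+n-o+p∣≤∣m-o∣+∣n-p∣ : ∀ m n o p → ∣ m + n - (o + p) ∣ ≤ ∣ m - o ∣ + ∣ n - p ∣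
  ∣m+n-o+p∣≤∣m-o∣+∣n-p∣ m n o p = begin
    ∣ m + n - (o + p) ∣                      ≤⟨ ∣-∣-triangle (m + n) (o + n) (o + p) ⟩
    ∣ m + n - (o + n) ∣ + ∣ o + n - (o + p) ∣  ≡⟨ cong₂ _+_ right-cancel (∣m+n-m+o∣≡∣n-o∣ o n p) ⟩
    ∣ m - o ∣ + ∣ n - p ∣                      ∎
    where
    open ≤-Reasoning
    right-cancel : ∣ m + n - (o + n) ∣ ≡ ∣ m - o ∣
    right-cancel rewrite +-comm m n | +-comm o n = ∣m+n-m+o∣≡∣n-o∣ n m o

  ∣m-n∣≤∣m+o-n+p∣+∣o-p∣ : ∀ m n o p → ∣ m - n ∣ ≤ ∣ m + o - (n + p) ∣ + ∣ o - p ∣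
  ∣m-n∣≤∣m+o-n+p∣+∣o-p∣ m n o p = begin
    ∣ m - n ∣                              ≡⟨ ∣m+n-m+o∣≡∣n-o∣ (o + p) m n ⟨
    ∣ (o + p) + m - (o + p) + n ∣          ≡⟨ cong₂ ∣_-_∣ (shuffle₁ o p m) (shuffle₂ o p n) ⟩
    ∣ (m + o) + p - ((n + p) + o) ∣        ≤⟨ ∣m+n-o+p∣≤∣m-o∣+∣n-p∣ (m + o) p (n + p) o ⟩
    ∣ m + o - (n + p) ∣ + ∣ p - o ∣        ≡⟨ cong (∣ m + o - (n + p) ∣ +_) (∣-∣-comm p o) ⟩
    ∣ m + o - (n + p) ∣ + ∣ o - p ∣        ∎
    where
    open ≤-Reasoning
    shuffle₁ : ∀ o p m → (o + p) + m ≡ (m + o) + p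
    shuffle₁ = solve 3 (λ o p m → (o :+ p) :+ m := (m :+ o) :+ p) refl
    shuffle₂ : ∀ o p n → (o + p) + n ≡ (n + p) + o
    shuffle₂ = solve 3 (λ o p n → (o :+ p) :+ n := (n :+ p) :+ o) refl

  ∣sumFin-sumFin∣≤sumFin∣-∣ : ∀ m (f g : Fin m → ℕ) →
    ∣ sumFin m f - sumFin m g ∣ ≤ sumFin m (λ j → ∣ f j - g j ∣)
  ∣sumFin-sumFin∣≤sumFin∣-∣ zero    f g = z≤n
  ∣sumFin-sumFin∣≤sumFin∣-∣ (suc m) f g = ≤-trans (∣m+n-o+p∣≤∣m-o∣+∣n-p∣ (f zero) _ (g zero) _)
    (+-monoʳ-≤ ∣ f zero - g zero ∣ (∣sumFin-sumFin∣≤sumFin∣-∣ m (λ j → f (suc j)) (λ j → g (suc j))))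

  variation-monoˡ-≤ : ∀ {N M} g → N ≤ M → variation N g ≤ variation M g
  variation-monoˡ-≤ g = sumTo-monoˡ-≤ (λ t → ∣ g t - g (t ∸ 1) ∣)

  variation-sumFin-≤ : ∀ N m (f : ℕ → Fin m → ℕ) →
    variation N (λ t → sumFin m (f t)) ≤ sumFin m (λ j → variation N (λ t → f t j))
  variation-sumFin-≤ N m f = begin
    variation N (λ t → sumFin m (f t))                            ≤⟨ sumTo-monoʳ-≤ N (λ t → ∣sumFin-sumFin∣≤sumFin∣-∣ m (f (suc t)) (f t)) ⟩
    sumTo N (λ t → sumFin m (λ j → ∣ f t j - f (t ∸ 1) j ∣))   ≡⟨ sumTo-sumFin-comm N m (λ t j → ∣ f t j - f (t ∸ 1) j ∣) ⟩
    sumFin m (λ j → variation N (λ t → f t j))                    ∎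
    where open ≤-Reasoning

  variation-monotone : ∀ N g → (∀ t → g t ≤ g (suc t)) → variation N g + g 0 ≡ g N
  variation-monotone zero    g mono = refl
  variation-monotone (suc N) g mono = begin
    variation N g + ∣ g (suc N) - g N ∣ + g 0     ≡⟨ solve 3 (λ v d z → v :+ d :+ z := v :+ z :+ d) refl (variation N g) ∣ g (suc N) - g N ∣ (g 0) ⟩
    variation N g + g 0 + ∣ g (suc N) - g N ∣     ≡⟨ cong₂ _+_ (variation-monotone N g mono) (m≤n⇒∣n-m∣≡n∸m (mono N)) ⟩
    g N + (g (suc N) ∸ g N)                       ≡⟨ m+[n∸m]≡n (mono N) ⟩
    g (suc N)                                     ∎
    where open ≡-Reasoning

  variation-step-≤ : ∀ N c → variation N (step c) ≤ 1
  variation-step-≤ N c = begin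
    variation N (step c)               ≤⟨ m≤m+n _ (step c 0) ⟩
    variation N (step c) + step c 0    ≡⟨ variation-monotone N (step c) (step-mono c) ⟩
    step c N                           ≤⟨ bit≤1 (c ≤ᵇ N) ⟩
    1                                  ∎
    where open ≤-Reasoning

  variation-interval-≤ : ∀ N {c d x} → IntervalIndicator c d x → variation N x ≤ 2
  variation-interval-≤ N {c} {d} {x} x-ind = begin
    variation N x                                      ≤⟨ sumTo-monoʳ-≤ N pointwise ⟩
    sumTo N (λ t → ∣ step c t - step c (t ∸ 1) ∣ + ∣ step d t - step d (t ∸ 1) ∣)
                                                       ≡⟨ sumTo-distrib-+ N _ _ ⟩
    variation N (step c) + variation N (step d)        ≤⟨ +-mono-≤ (variation-step-≤ N c) (variation-step-≤ N d) ⟩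
    2                                                  ∎
    where
    open ≤-Reasoning
    pointwise : ∀ t → ∣ x (suc t) - x t ∣ ≤ ∣ step c (suc t) - step c t ∣ + ∣ step d (suc t) - step d t ∣
    pointwise t rewrite sym (x-ind .split (suc t)) | sym (x-ind .split t) =
      ∣m-n∣≤∣m+o-n+p∣+∣o-p∣ (x (suc t)) (x t) (step d (suc t)) (step d t)

  variation-perturb-≤ : ∀ N (f g e : ℕ → ℕ) → (∀ t → ∣ f t - g t ∣ ≤ e t) → e 0 ≡ 0 →
    variation N f ≤ variation N g + (sumTo N e + sumTo N e)
  variation-perturb-≤ N f g e f≈g e0≡0 = begin
    variation N f                                                ≤⟨ sumTo-monoʳ-≤ N pointwise ⟩
    sumTo N (λ t → e t + ∣ g t - g (t ∸ 1) ∣ + e (t ∸ 1))     ≡⟨ sumTo-distrib-+ N _ _ ⟩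
    sumTo N (λ t → e t + ∣ g t - g (t ∸ 1) ∣) + sumTo N (λ t → e (t ∸ 1))
                                                                 ≤⟨ +-monoʳ-≤ _ (sumTo-pred-≤ N e e0≡0) ⟩
    sumTo N (λ t → e t + ∣ g t - g (t ∸ 1) ∣) + sumTo N e     ≡⟨ cong (_+ sumTo N e) (sumTo-distrib-+ N e _) ⟩
    sumTo N e + variation N g + sumTo N e                        ≡⟨ solve 2 (λ E V → E :+ V :+ E := V :+ (E :+ E)) refl (sumTo N e) (variation N g) ⟩
    variation N g + (sumTo N e + sumTo N e)                      ∎
    where
    open ≤-Reasoning
    pointwise : ∀ t → ∣ f (suc t) - f t ∣ ≤ e (suc t) + ∣ g (suc t) - g t ∣ + e t
    pointwise t = begin
      ∣ f (suc t) - f t ∣                                          ≤⟨ ∣-∣-triangle (f (suc t)) (g (suc t)) (f t) ⟩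
      ∣ f (suc t) - g (suc t) ∣ + ∣ g (suc t) - f t ∣              ≤⟨ +-mono-≤ (f≈g (suc t)) (∣-∣-triangle (g (suc t)) (g t) (f t)) ⟩
      e (suc t) + (∣ g (suc t) - g t ∣ + ∣ g t - f t ∣)            ≤⟨ +-monoʳ-≤ (e (suc t)) (+-monoʳ-≤ _ (subst (_≤ e t) (∣-∣-comm (f t) (g t)) (f≈g t))) ⟩
      e (suc t) + (∣ g (suc t) - g t ∣ + e t)                      ≡⟨ +-assoc (e (suc t)) _ _ ⟨
      e (suc t) + ∣ g (suc t) - g t ∣ + e t                        ∎

module Greedy (m : ℕ) (a : Fin m → ℕ) (w : ℕ) (1≤a : ∀ j → 1 ≤ a j) where

  open import Data.Nat
  open import Data.Nat.Properties
  open import Data.Bool using (true; false; _∧_)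
  open import Data.Product using (_,_)
  open import Relation.Binary.PropositionalEquality
  open import Relation.Nullary using (yes; no)
  open Model m a w
  open Summation
  open Indicators
  open Variation

  private
    suc-⊓-step : ∀ d → d ⊓ w + bit (d ⊓ w <ᵇ w) ≡ suc d ⊓ w
    suc-⊓-step d with d <? w
    ... | yes d<w rewrite m≤n⇒m⊓n≡m (<⇒≤ d<w) | <ᵇ-true d<w | m≤n⇒m⊓n≡m d<w = +-comm d 1
    ... | no  d≮w rewrite m≥n⇒m⊓n≡n (≮⇒≥ d≮w) | <ᵇ-false (≤-refl {w})
                        | m≥n⇒m⊓n≡n (m≤n⇒m≤1+n (≮⇒≥ d≮w)) = +-identityʳ w

    afWork-step : ∀ c t → (suc t ∸ c) ⊓ w + bit ((c ≤ᵇ suc t) ∧ ((suc t ∸ c) ⊓ w <ᵇ w)) ≡ (suc (suc t) ∸ c) ⊓ w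
    afWork-step c t with c ≤? suc t
    ... | yes c≤1+t rewrite ≤ᵇ-true c≤1+t | +-∸-assoc 1 c≤1+t = suc-⊓-step (suc t ∸ c)
    ... | no  c≰1+t rewrite ≤ᵇ-false (≰⇒> c≰1+t) | m≤n⇒m∸n≡0 (<⇒≤ (≰⇒> c≰1+t))
                          | m≤n⇒m∸n≡0 (≰⇒> c≰1+t) = refl

    window-step : ∀ c t → bit ((c ≤ᵇ t) ∧ ((t ∸ c) ⊓ w <ᵇ w)) + bit (c + w ≤ᵇ t) ≡ bit (c ≤ᵇ t)
    window-step c t with c ≤? t
    ... | no  c≰t rewrite ≤ᵇ-false (≰⇒> c≰t) | ≤ᵇ-false (≤-trans (≰⇒> c≰t) (m≤m+n c w)) = refl
    ... | yes c≤t rewrite ≤ᵇ-true c≤t with (t ∸ c) <? w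
    ...   | yes d<w rewrite m≤n⇒m⊓n≡m (<⇒≤ d<w) | <ᵇ-true d<w
                          | ≤ᵇ-false (subst (_< c + w) (m+[n∸m]≡n c≤t) (+-monoʳ-< c d<w)) = refl
    ...   | no  d≮w rewrite m≥n⇒m⊓n≡n (≮⇒≥ d≮w) | <ᵇ-false (≤-refl {w})
                          | ≤ᵇ-true (subst (c + w ≤_) (m+[n∸m]≡n c≤t) (+-monoʳ-≤ c (≮⇒≥ d≮w))) = refl

  afWork-closed : ∀ t j → afWork t j ≡ (suc t ∸ a j) ⊓ w
  afWork-closed zero    j rewrite m≤n⇒m∸n≡0 (1≤a j) = refl
  afWork-closed (suc t) j rewrite afWork-closed t j = afWork-step (a j) t

  work-afP : ∀ t j → work afP t j ≡ afWork t j
  work-afP zero    j = refl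
  work-afP (suc t) j = cong (_+ bit (afP (suc t) j)) (work-afP t j)

  not-outstanding-at-0 : ∀ q j → outstanding q 0 j ≡ false
  not-outstanding-at-0 q j rewrite ≤ᵇ-false {a j} {0} (1≤a j) = refl

  outstanding-afP : ∀ t j → outstanding afP t j ≡ afP t j
  outstanding-afP zero    j = not-outstanding-at-0 afP j
  outstanding-afP (suc t) j rewrite work-afP t j = refl

  afP-interval : ∀ j → IntervalIndicator (a j) (a j + w) (λ t → bit (outstanding afP t j))
  afP-interval j .split zero
    rewrite not-outstanding-at-0 afP j | ≤ᵇ-false {a j + w} {0} (≤-trans (1≤a j) (m≤m+n (a j) w))
          | ≤ᵇ-false {a j} {0} (1≤a j) = refl
  afP-interval j .split (suc t) rewrite outstanding-afP (suc t) j | afWork-closed t j = window-step (a j) (suc t)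

  OnlyOutstanding : Pattern → Set
  OnlyOutstanding p = ∀ t j → p t j ≡ true → outstanding p t j ≡ true

  work-≤-greedy : ∀ p → OnlyOutstanding p → ∀ t j → work p t j ≤ (suc t ∸ a j) ⊓ w
  work-≤-greedy p valid zero    j = z≤n
  work-≤-greedy p valid (suc t) j with p (suc t) j in processed
  ... | false = begin
    work p t j + 0              ≡⟨ +-identityʳ _ ⟩
    work p t j                  ≤⟨ work-≤-greedy p valid t j ⟩
    (suc t ∸ a j) ⊓ w           ≤⟨ ⊓-monoˡ-≤ w (∸-monoˡ-≤ (a j) (n≤1+n (suc t))) ⟩
    (suc (suc t) ∸ a j) ⊓ w     ∎
    where open ≤-Reasoning
  ... | true with ∧-true⁻¹ {a j ≤ᵇ suc t} {work p t j <ᵇ w} (valid (suc t) j processed)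
  ...   | arrived , unfinished = ⊓-glb (begin
    work p t j + 1              ≡⟨ +-comm _ 1 ⟩
    suc (work p t j)            ≤⟨ s≤s (≤-trans (work-≤-greedy p valid t j) (m⊓n≤m _ w)) ⟩
    suc (suc t ∸ a j)           ≡⟨ +-∸-assoc 1 (≤ᵇ-true⁻¹ {a j} {suc t} arrived) ⟨
    suc (suc t) ∸ a j           ∎)
    (subst (_≤ w) (+-comm 1 _) (<ᵇ-true⁻¹ unfinished))
    where open ≤-Reasoning

  outstanding-afP⇒outstanding : ∀ p → OnlyOutstanding p → ∀ t j → outstanding afP t j ≡ true → outstanding p t j ≡ true
  outstanding-afP⇒outstanding p valid zero    j afP-out rewrite not-outstanding-at-0 afP j = afP-out
  outstanding-afP⇒outstanding p valid (suc t) j afP-out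
    rewrite outstanding-afP (suc t) j with ∧-true⁻¹ {a j ≤ᵇ suc t} {afWork t j <ᵇ w} afP-out
  ... | arrived , unfinished rewrite arrived = <ᵇ-true (begin-strict
    work p t j              ≤⟨ work-≤-greedy p valid t j ⟩
    (suc t ∸ a j) ⊓ w       ≡⟨ afWork-closed t j ⟨
    afWork t j              <⟨ <ᵇ-true⁻¹ unfinished ⟩
    w                       ∎)
    where open ≤-Reasoning

  greedyFlow greedySwitching : ℕ
  greedyFlow      = sumTo afHorizon afS
  greedySwitching = variation (suc afHorizon) afS

  sumTo-afS : ∀ N → afHorizon ≤ N → sumTo N afS ≡ m * w
  sumTo-afS N H≤N = begin
    sumTo N afS                                                   ≡⟨ sumTo-sumFin-comm N m (λ t j → bit (outstanding afP t j)) ⟩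
    sumFin m (λ j → sumTo N (λ t → bit (outstanding afP t j)))    ≡⟨ sumFin-cong m job-flow ⟩
    sumFin m (λ _ → w)                                            ≡⟨ sumFin-const m w ⟩
    m * w                                                         ∎
    where
    open ≡-Reasoning
    job-flow : ∀ j → sumTo N (λ t → bit (outstanding afP t j)) ≡ w
    job-flow j = trans (sumTo-interval N (afP-interval j) (1≤a j) (m≤m+n (a j) w)
                          (≤-trans (+-monoˡ-≤ w (term≤maxFin m a j)) (≤-trans H≤N (n≤1+n N))))
                       (m+n∸m≡n (a j) w)

  variation-afS-≤ : ∀ N → variation N afS ≤ m * 2
  variation-afS-≤ N = begin
    variation N afS                                                 ≤⟨ variation-sumFin-≤ N m (λ t j → bit (outstanding afP t j)) ⟩
    sumFin m (λ j → variation N (λ t → bit (outstanding afP t j)))  ≤⟨ sumFin-mono-≤ m (λ j → variation-interval-≤ N (afP-interval j)) ⟩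
    sumFin m (λ _ → 2)                                              ≡⟨ sumFin-const m 2 ⟩
    m * 2                                                           ∎
    where open ≤-Reasoning

module FeasibleSchedule (m : ℕ) (a : Fin m → ℕ) (w : ℕ) (1≤w : 1 ≤ w) (1≤a : ∀ j → 1 ≤ a j)
                        (S : Model.Schedule m a w) where

  open import Data.Nat
  open import Data.Nat.Properties
  open import Data.Bool using (true; false)
  open import Data.Bool.Properties using (∧-zeroʳ)
  open import Relation.Binary.PropositionalEquality
  open import Relation.Nullary using (yes; no)
  open import Data.Nat.Solver using (module +-*-Solver)
  open +-*-Solver
  open Model m a w
  open Schedule S
  open Summation
  open Indicators
  open Variation
  open Greedy m a w 1≤a

  flow switching : ℕ
  flow      = sumTo T (nOut p)
  switching = variation (suc T) s

  load : ℕ → ℕ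
  load t = sumFin m (λ j → bit (p t j))

  sumTo-load : sumTo T load ≡ m * w
  sumTo-load = begin
    sumTo T load                ≡⟨ sumTo-sumFin-comm T m (λ t j → bit (p t j)) ⟩
    sumFin m (work p T)         ≡⟨ sumFin-cong m complete ⟩
    sumFin m (λ _ → w)          ≡⟨ sumFin-const m w ⟩
    m * w                       ∎
    where open ≡-Reasoning

  sumTo-arrivingWork-≤ : ∀ t → sumTo t arrivingWork ≤ m * w
  sumTo-arrivingWork-≤ t = begin
    sumTo t arrivingWork                                     ≡⟨ sumTo-distribˡ-* t w _ ⟩
    w * sumTo t (λ τ → sumFin m (λ j → pulse (a j) τ))       ≡⟨ cong (w *_) (sumTo-sumFin-comm t m (λ τ j → pulse (a j) τ)) ⟩
    w * sumFin m (λ j → sumTo t (pulse (a j)))               ≤⟨ *-monoʳ-≤ w (sumFin-mono-≤ m arrives-once) ⟩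
    w * sumFin m (λ _ → 1)                                   ≡⟨ cong (w *_) (trans (sumFin-const m 1) (*-identityʳ m)) ⟩
    w * m                                                    ≡⟨ *-comm w m ⟩
    m * w                                                    ∎
    where
    open ≤-Reasoning
    arrives-once : ∀ j → sumTo t (pulse (a j)) ≤ 1
    arrives-once j = subst (_≤ 1) (sym (sumTo-pulse (a j) t (1≤a j))) (bit≤1 (a j ≤ᵇ t))

  -- Work neutrality leaves no room for idle servers: the capacity inequality is tight.
  s≡load : ∀ t → s t ≡ load t
  s≡load zero    = trans s0 (sym (n≤0⇒n≡0 (subst (load 0 ≤_) s0 (capacity 0))))
  s≡load (suc t) with t <? T
  ... | yes t<T = sym (sumTo-squeeze T (λ t → capacity (suc t)) Σs≤Σload t t<T)
    where
    Σs≤Σload : sumTo T s ≤ sumTo T load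
    Σs≤Σload = ≤-trans (neutral T) (≤-trans (sumTo-arrivingWork-≤ T) (≤-reflexive (sym sumTo-load)))
  ... | no  t≮T = trans idle (sym (n≤0⇒n≡0 (subst (load (suc t) ≤_) idle (capacity (suc t)))))
    where
    idle : s (suc t) ≡ 0
    idle = sAfter (suc t) (s≤s (≮⇒≥ t≮T))

  work≤flow : m * w ≤ flow
  work≤flow = subst (_≤ flow) sumTo-load (sumTo-monoʳ-≤ T (λ t → sumFin-mono-≤ m (processed≤outstanding (suc t))))
    where
    processed≤outstanding : ∀ t j → bit (p t j) ≤ bit (outstanding p t j)
    processed≤outstanding t j with p t j in processed
    ... | false = z≤n
    ... | true  rewrite valid t j processed = ≤-refl

  nOut-beyond : ∀ t → T < t → nOut p t ≡ 0
  nOut-beyond (suc t) (s≤s T≤t) = sumFin-zero m _ finished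
    where
    finished : ∀ j → bit (outstanding p (suc t) j) ≡ 0
    finished j rewrite <ᵇ-false (subst (_≤ work p t j) (complete j) (sumTo-monoˡ-≤ (λ τ → bit (p τ j)) T≤t))
                     | ∧-zeroʳ (a j ≤ᵇ suc t) = refl

  mismatch : ℕ → ℕ
  mismatch t = sumFin m (λ j → ∣ bit (outstanding afP t j) - bit (p t j) ∣)

  unprocessed-at-0 : ∀ j → p 0 j ≡ false
  unprocessed-at-0 j with p 0 j in processed
  ... | false = refl
  ... | true  with () ← trans (sym (valid 0 j processed)) (not-outstanding-at-0 p j)

  mismatch-0 : mismatch 0 ≡ 0
  mismatch-0 = sumFin-zero m _ idle
    where
    idle : ∀ j → ∣ bit (outstanding afP 0 j) - bit (p 0 j) ∣ ≡ 0
    idle j rewrite not-outstanding-at-0 afP j | unprocessed-at-0 j = refl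

  mismatch+afS+load≤2nOut : ∀ t → mismatch t + (afS t + load t) ≤ nOut p t + nOut p t
  mismatch+afS+load≤2nOut t = begin
    mismatch t + (afS t + load t)                         ≡⟨ cong (mismatch t +_) (sumFin-distrib-+ m x y) ⟨
    mismatch t + sumFin m (λ j → x j + y j)               ≡⟨ sumFin-distrib-+ m _ _ ⟨
    sumFin m (λ j → ∣ x j - y j ∣ + (x j + y j))          ≤⟨ sumFin-mono-≤ m (λ j → bit-mismatch-≤ _ _ _
                                                               (outstanding-afP⇒outstanding p valid t j) (valid t j)) ⟩
    sumFin m (λ j → z j + z j)                            ≡⟨ sumFin-distrib-+ m z z ⟩
    nOut p t + nOut p t                                   ∎
    where
    open ≤-Reasoning
    x y z : Fin m → ℕ
    x j = bit (outstanding afP t j)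
    y j = bit (p t j)
    z j = bit (outstanding p t j)

  horizon : ℕ
  horizon = suc (afHorizon + T)

  T≤horizon : T ≤ horizon
  T≤horizon = m≤n⇒m≤1+n (m≤n+m T afHorizon)

  totalMismatch : ℕ
  totalMismatch = sumTo horizon mismatch

  totalMismatch+2work≤2flow : totalMismatch + (m * w + m * w) ≤ flow + flow
  totalMismatch+2work≤2flow = begin
    totalMismatch + (m * w + m * w)                           ≤⟨ +-monoʳ-≤ totalMismatch (+-mono-≤ afS-flow load-flow) ⟩
    totalMismatch + (sumTo N afS + sumTo N load)              ≡⟨ cong (totalMismatch +_) (sumTo-distrib-+ N afS load) ⟨
    totalMismatch + sumTo N (λ t → afS t + load t)            ≡⟨ sumTo-distrib-+ N mismatch _ ⟨
    sumTo N (λ t → mismatch t + (afS t + load t))             ≤⟨ sumTo-monoʳ-≤ N (λ t → mismatch+afS+load≤2nOut (suc t)) ⟩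
    sumTo N (λ t → nOut p t + nOut p t)                       ≡⟨ sumTo-distrib-+ N (nOut p) (nOut p) ⟩
    sumTo N (nOut p) + sumTo N (nOut p)                       ≡⟨ cong₂ _+_ flow-tail flow-tail ⟩
    flow + flow                                               ∎
    where
    open ≤-Reasoning
    N : ℕ
    N = horizon
    afS-flow : m * w ≤ sumTo N afS
    afS-flow = ≤-reflexive (sym (sumTo-afS N (m≤n⇒m≤1+n (m≤m+n afHorizon T))))
    load-flow : m * w ≤ sumTo N load
    load-flow = subst (_≤ sumTo N load) sumTo-load (sumTo-monoˡ-≤ load T≤horizon)
    flow-tail : sumTo N (nOut p) ≡ flow
    flow-tail = sumTo-zero-tail N (nOut p) nOut-beyond T≤horizon

  greedySwitching≤switching+2totalMismatch : greedySwitching ≤ switching + (totalMismatch + totalMismatch)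
  greedySwitching≤switching+2totalMismatch = begin
    greedySwitching                                      ≤⟨ variation-monoˡ-≤ afS (s≤s (m≤m+n afHorizon T)) ⟩
    variation horizon afS                                ≤⟨ variation-perturb-≤ horizon afS s mismatch afS≈s mismatch-0 ⟩
    variation horizon s + (totalMismatch + totalMismatch) ≡⟨ cong (_+ (totalMismatch + totalMismatch)) switching-tail ⟩
    switching + (totalMismatch + totalMismatch)          ∎
    where
    open ≤-Reasoning
    afS≈s : ∀ t → ∣ afS t - s t ∣ ≤ mismatch t
    afS≈s t rewrite s≡load t = ∣sumFin-sumFin∣≤sumFin∣-∣ m _ _
    s-steady : ∀ t → suc T < t → ∣ s t - s (t ∸ 1) ∣ ≡ 0
    s-steady (suc t) (s≤s T<t) rewrite sAfter (suc t) (m<n⇒m<1+n T<t) | sAfter t T<t = refl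
    switching-tail : variation horizon s ≡ switching
    switching-tail = sumTo-zero-tail horizon _ s-steady (s≤s (m≤n+m T afHorizon))

  private
    averaged-bound : ∀ {X v V D F} → v ≤ X + X → v ≤ V + (D + D) → D + (X + X) ≤ F + F → X + v ≤ 2 * F + V
    averaged-bound {X} {v} {V} {D} {F} v≤2X v≤V+2D D+2X≤2F = *-cancelˡ-≤ 2 (begin
      2 * (X + v)                           ≡⟨ solve 2 (λ X v → con 2 :* (X :+ v) := (X :+ X) :+ (v :+ v)) refl X v ⟩
      (X + X) + (v + v)                     ≤⟨ +-monoʳ-≤ (X + X) (+-mono-≤ v≤2X v≤V+2D) ⟩
      (X + X) + ((X + X) + (V + (D + D)))   ≡⟨ solve 3 (λ X V D → (X :+ X) :+ ((X :+ X) :+ (V :+ (D :+ D)))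
                                                              := V :+ con 2 :* (D :+ (X :+ X))) refl X V D ⟩
      V + 2 * (D + (X + X))                 ≤⟨ +-monoʳ-≤ V (*-monoʳ-≤ 2 D+2X≤2F) ⟩
      V + 2 * (F + F)                       ≤⟨ m≤m+n _ V ⟩
      V + 2 * (F + F) + V                   ≡⟨ solve 2 (λ V F → V :+ con 2 :* (F :+ F) :+ V := con 2 :* (con 2 :* F :+ V)) refl V F ⟩
      2 * (2 * F + V)                       ∎)
      where open ≤-Reasoning

  greedyFlow≤2flow : greedyFlow ≤ 2 * flow
  greedyFlow≤2flow = begin
    greedyFlow    ≡⟨ sumTo-afS afHorizon ≤-refl ⟩
    m * w         ≤⟨ work≤flow ⟩
    flow          ≤⟨ m≤n*m flow 2 ⟩
    2 * flow      ∎
    where open ≤-Reasoning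

  greedyCost≤2cost : greedyFlow + greedySwitching ≤ 2 * flow + 2 * switching
  greedyCost≤2cost = begin
    greedyFlow + greedySwitching    ≡⟨ cong (_+ greedySwitching) (sumTo-afS afHorizon ≤-refl) ⟩
    m * w + greedySwitching         ≤⟨ averaged-bound {X = m * w} {D = totalMismatch} {F = flow} greedySwitching≤2work
                                         greedySwitching≤switching+2totalMismatch totalMismatch+2work≤2flow ⟩
    2 * flow + switching            ≤⟨ +-monoʳ-≤ (2 * flow) (m≤n*m switching 2) ⟩
    2 * flow + 2 * switching        ∎
    where
    open ≤-Reasoning
    greedySwitching≤2work : greedySwitching ≤ m * w + m * w
    greedySwitching≤2work = begin
      greedySwitching     ≤⟨ variation-afS-≤ (suc afHorizon) ⟩
      m * 2               ≤⟨ *-monoʳ-≤ m (+-mono-≤ 1≤w 1≤w) ⟩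
      m * (w + w)         ≡⟨ *-distribˡ-+ m w w ⟩
      m * w + m * w       ∎

module UnitJobs (m : ℕ) (a : Fin m → ℕ) (1≤a : ∀ j → 1 ≤ a j) (T : ℕ) (slot : Fin m → ℕ)
                (a≤slot : ∀ j → a j ≤ slot j) (slot≤T : ∀ j → slot j ≤ T) where

  open import Data.Nat
  open import Data.Nat.Properties
  open import Data.Bool using (true; _∧_)
  open import Data.Bool.Properties using (∧-zeroʳ; ∧-identityʳ)
  open import Data.Product using (_,_)
  open import Relation.Binary.PropositionalEquality
  open import Relation.Nullary using (yes; no)
  open Model m a 1
  open Summation
  open Indicators
  open Greedy m a 1 1≤a using (OnlyOutstanding; not-outstanding-at-0)

  unitPattern : Pattern
  unitPattern t j = (slot j ≤ᵇ t) ∧ (t ≤ᵇ slot j)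

  unitLoad : ℕ → ℕ
  unitLoad t = sumFin m (λ j → pulse (slot j) t)

  1≤slot : ∀ j → 1 ≤ slot j
  1≤slot j = ≤-trans (1≤a j) (a≤slot j)

  work-unitPattern : ∀ t j → work unitPattern t j ≡ step (slot j) t
  work-unitPattern t j = sumTo-pulse (slot j) t (1≤slot j)

  valid-unitPattern : OnlyOutstanding unitPattern
  valid-unitPattern t j at-slot with ∧-true⁻¹ {slot j ≤ᵇ t} {t ≤ᵇ slot j} at-slot
  ... | slot≤t , t≤slot with ≤-antisym (≤ᵇ-true⁻¹ {slot j} {t} slot≤t) (≤ᵇ-true⁻¹ {t} {slot j} t≤slot)
  ... | refl rewrite ≤ᵇ-true (a≤slot j) | work-unitPattern (slot j ∸ 1) j
                   | ≤ᵇ-false (∸-monoʳ-< {slot j} {1} {0} (s≤s z≤n) (1≤slot j)) = refl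

  outstanding-interval : ∀ j → IntervalIndicator (a j) (suc (slot j)) (λ t → bit (outstanding unitPattern t j))
  outstanding-interval j .split zero
    rewrite not-outstanding-at-0 unitPattern j | ≤ᵇ-false {a j} {0} (1≤a j) = refl
  outstanding-interval j .split (suc t) rewrite work-unitPattern t j | suc-≤ᵇ-suc (slot j) t with slot j ≤? t
  ... | yes slot≤t rewrite ≤ᵇ-true slot≤t | ∧-zeroʳ (a j ≤ᵇ suc t)
                         | ≤ᵇ-true (m≤n⇒m≤1+n (≤-trans (a≤slot j) slot≤t)) = refl
  ... | no  slot≰t rewrite ≤ᵇ-false (≰⇒> slot≰t) | ∧-identityʳ (a j ≤ᵇ suc t) = +-identityʳ _

  neutral-unitLoad : ∀ t → sumTo t unitLoad ≤ sumTo t arrivingWork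
  neutral-unitLoad t = begin
    sumTo t unitLoad                                        ≡⟨ sumTo-sumFin-comm t m (λ τ j → pulse (slot j) τ) ⟩
    sumFin m (λ j → sumTo t (pulse (slot j)))               ≡⟨ sumFin-cong m (λ j → sumTo-pulse (slot j) t (1≤slot j)) ⟩
    sumFin m (λ j → step (slot j) t)                        ≤⟨ sumFin-mono-≤ m (λ j → step-antimono t (a≤slot j)) ⟩
    sumFin m (λ j → step (a j) t)                           ≡⟨ sumFin-cong m (λ j → sumTo-pulse (a j) t (1≤a j)) ⟨
    sumFin m (λ j → sumTo t (pulse (a j)))                  ≡⟨ sumTo-sumFin-comm t m (λ τ j → pulse (a j) τ) ⟨
    sumTo t (λ τ → sumFin m (λ j → pulse (a j) τ))          ≡⟨ sumTo-cong t (λ τ → *-identityˡ _) ⟨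
    sumTo t arrivingWork                                    ∎
    where open ≤-Reasoning

  unitLoad-0 : unitLoad 0 ≡ 0
  unitLoad-0 = sumFin-zero m _ (λ j → pulse-≢ (λ slot≡0 → <⇒≢ (1≤slot j) (sym slot≡0)))

  unitLoad-beyond : ∀ t → T < t → unitLoad t ≡ 0
  unitLoad-beyond t T<t = sumFin-zero m _ (λ j → pulse-≢ (<⇒≢ (≤-<-trans (slot≤T j) T<t)))

  unitSchedule : Schedule
  unitSchedule = record
    { T        = T
    ; s        = unitLoad
    ; p        = unitPattern
    ; s0       = unitLoad-0
    ; sAfter   = unitLoad-beyond
    ; valid    = valid-unitPattern
    ; capacity = λ t → ≤-refl
    ; neutral  = neutral-unitLoad
    ; complete = λ j → trans (work-unitPattern T j) (cong bit (≤ᵇ-true (slot≤T j)))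
    }

  flow-unitSchedule : sumTo T (nOut unitPattern) ≡ sumFin m (λ j → suc (slot j) ∸ a j)
  flow-unitSchedule = begin
    sumTo T (nOut unitPattern)                                           ≡⟨ sumTo-sumFin-comm T m _ ⟩
    sumFin m (λ j → sumTo T (λ t → bit (outstanding unitPattern t j)))   ≡⟨ sumFin-cong m job-flow ⟩
    sumFin m (λ j → suc (slot j) ∸ a j)                                  ∎
    where
    open ≡-Reasoning
    job-flow : ∀ j → sumTo T (λ t → bit (outstanding unitPattern t j)) ≡ suc (slot j) ∸ a j
    job-flow j = sumTo-interval T (outstanding-interval j) (1≤a j) (m≤n⇒m≤1+n (a≤slot j)) (s≤s (slot≤T j))

module Staggered where

  open import Data.Nat
  open import Data.Nat.Properties
  open import Data.Fin using (zero; suc)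
  open import Data.Sum using (inj₁; inj₂)
  open import Relation.Binary.PropositionalEquality
  open import Data.Nat.Solver using (module +-*-Solver)
  open +-*-Solver
  open Summation
  open Indicators
  open Variation

  double : ℕ → ℕ
  double zero    = 0
  double (suc k) = suc (suc (double k))

  -- Pair i of jobs arrives in slot 2i+1 (pairs listed latest first); the staggered
  -- schedule serves one job of each pair on arrival and the other one slot later.
  arrival slot : (k : ℕ) → Fin (double k) → ℕ
  arrival (suc k) zero          = suc (double k)
  arrival (suc k) (suc zero)    = suc (double k)
  arrival (suc k) (suc (suc j)) = arrival k j
  slot    (suc k) zero          = suc (double k)
  slot    (suc k) (suc zero)    = suc (suc (double k))
  slot    (suc k) (suc (suc j)) = slot k j

  1≤arrival : ∀ k j → 1 ≤ arrival k j
  1≤arrival (suc k) zero          = s≤s z≤n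
  1≤arrival (suc k) (suc zero)    = s≤s z≤n
  1≤arrival (suc k) (suc (suc j)) = 1≤arrival k j

  arrival≤slot : ∀ k j → arrival k j ≤ slot k j
  arrival≤slot (suc k) zero          = ≤-refl
  arrival≤slot (suc k) (suc zero)    = n≤1+n _
  arrival≤slot (suc k) (suc (suc j)) = arrival≤slot k j

  slot≤double : ∀ k j → slot k j ≤ double k
  slot≤double (suc k) zero          = n≤1+n _
  slot≤double (suc k) (suc zero)    = ≤-refl
  slot≤double (suc k) (suc (suc j)) = m≤n⇒m≤1+n (m≤n⇒m≤1+n (slot≤double k j))

  double≡k+k : ∀ k → double k ≡ k + k
  double≡k+k zero    = refl
  double≡k+k (suc k) = cong suc (trans (cong suc (double≡k+k k)) (sym (+-suc k k)))

  double<double : ∀ {i k} → i < k → double i < double k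
  double<double {zero}  {suc k} _         = s≤s z≤n
  double<double {suc i} {suc k} (s≤s i<k) = s≤s (s≤s (double<double i<k))

  odd≢double : ∀ k i → suc (double k) ≢ double i
  odd≢double k       zero    ()
  odd≢double zero    (suc i) ()
  odd≢double (suc k) (suc i) eq = odd≢double k i (suc-injective (suc-injective eq))

  flow-staggered : ∀ k → sumFin (double k) (λ j → suc (slot k j) ∸ arrival k j) ≡ 3 * k
  flow-staggered zero    = refl
  flow-staggered (suc k) rewrite m+n∸n≡m 1 (double k) | m+n∸n≡m 2 (double k) | flow-staggered k =
    solve 1 (λ k → con 1 :+ (con 2 :+ con 3 :* k) := con 3 :* (con 1 :+ k)) refl k

  staggeredLoad : ℕ → ℕ → ℕ
  staggeredLoad k t = sumFin (double k) (λ j → pulse (slot k j) t)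

  staggeredLoad-interval : ∀ k → IntervalIndicator 1 (suc (double k)) (staggeredLoad k)
  staggeredLoad-interval zero    .split t = refl
  staggeredLoad-interval (suc k) .split t = begin
    (pulse (suc D) t + (pulse (suc (suc D)) t + L)) + step (suc (suc (suc D))) t
                                                       ≡⟨ solve 4 (λ x y l z → (x :+ (y :+ l)) :+ z := l :+ (x :+ (y :+ z))) refl
                                                                  (pulse (suc D) t) (pulse (suc (suc D)) t) L (step (suc (suc (suc D))) t) ⟩
    L + (pulse (suc D) t + (pulse (suc (suc D)) t + step (suc (suc (suc D))) t))
                                                       ≡⟨ cong (λ n → L + (pulse (suc D) t + n)) (pulse-interval (suc (suc D)) .split t) ⟩
    L + (pulse (suc D) t + step (suc (suc D)) t)       ≡⟨ cong (L +_) (pulse-interval (suc D) .split t) ⟩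
    L + step (suc D) t                                 ≡⟨ staggeredLoad-interval k .split t ⟩
    step 1 t                                           ∎
    where
    open ≡-Reasoning
    D L : ℕ
    D = double k
    L = staggeredLoad k t

  double≤lastArrival+2 : ∀ k → double k ≤ suc (maxFin (double k) (arrival k) + 1)
  double≤lastArrival+2 zero    = z≤n
  double≤lastArrival+2 (suc k) = s≤s (≤-trans (term≤maxFin (double (suc k)) (arrival (suc k)) zero) (m≤m+n _ 1))

  arrivals : ℕ → ℕ → ℕ
  arrivals k t = sumFin (double k) (λ j → pulse (arrival k j) t)

  arrivals-beyond : ∀ k t → double k < t → arrivals k t ≡ 0
  arrivals-beyond k t k<t = sumFin-zero (double k) _ (λ j → pulse-≢ (<⇒≢ (≤-<-trans
    (≤-trans (arrival≤slot k j) (slot≤double k j)) k<t)))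

  arrivals-even : ∀ k i → arrivals k (double i) ≡ 0
  arrivals-even zero    i = refl
  arrivals-even (suc k) i rewrite pulse-≢ (odd≢double k i) | arrivals-even k i = refl

  arrivals-odd : ∀ k i → i < k → arrivals k (suc (double i)) ≡ 2
  arrivals-odd (suc k) i (s≤s i≤k) with m≤n⇒m<n∨m≡n i≤k
  ... | inj₁ i<k rewrite pulse-≢ {suc (double k)} {suc (double i)} (λ eq → <⇒≢ (double<double i<k) (sym (suc-injective eq)))
                       | arrivals-odd k i i<k = refl
  ... | inj₂ refl rewrite pulse-self (suc (double i)) | arrivals-beyond i (suc (double i)) ≤-refl = refl

  sumTo-pairs-≥ : ∀ n (f : ℕ → ℕ) c → (∀ i → i < n → c ≤ f (suc (double i)) + f (suc (suc (double i)))) →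
                   n * c ≤ sumTo (double n) f
  sumTo-pairs-≥ zero    f c pairs = z≤n
  sumTo-pairs-≥ (suc n) f c pairs = begin
    c + n * c                                                    ≡⟨ +-comm c (n * c) ⟩
    n * c + c                                                    ≤⟨ +-mono-≤ (sumTo-pairs-≥ n f c (λ i i<n → pairs i (m≤n⇒m≤1+n i<n))) (pairs n ≤-refl) ⟩
    sumTo (double n) f + (f (suc (double n)) + f (suc (suc (double n))))
                                                                 ≡⟨ +-assoc (sumTo (double n) f) _ _ ⟨
    sumTo (double (suc n)) f                                     ∎
    where open ≤-Reasoning

  variation-arrivals-≥ : ∀ k → k * 4 ≤ variation (double k) (arrivals k)
  variation-arrivals-≥ k = sumTo-pairs-≥ k _ 4 up-and-down
    where
    up-and-down : ∀ i → i < k → 4 ≤ ∣ arrivals k (suc (double i)) - arrivals k (double i) ∣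
                                  + ∣ arrivals k (suc (suc (double i))) - arrivals k (suc (double i)) ∣
    up-and-down i i<k rewrite arrivals-odd k i i<k | arrivals-even k i | arrivals-even k (suc i) = ≤-refl

module StaggeredCosts (k : ℕ) where

  open import Data.Nat
  open import Data.Nat.Properties
  open import Relation.Binary.PropositionalEquality
  open import Data.Nat.Solver using (module +-*-Solver)
  open +-*-Solver
  open Staggered
  open Model (double k) (arrival k) 1
  open Summation
  open Indicators
  open Variation
  open UnitJobs (double k) (arrival k) (1≤arrival k) (double k) (slot k) (arrival≤slot k) (slot≤double k) public
  open Greedy (double k) (arrival k) 1 (1≤arrival k) public
  open FeasibleSchedule (double k) (arrival k) 1 ≤-refl (1≤arrival k) unitSchedule public

  flow+switching≤3k+2 : flow + switching ≤ 3 * k + 2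
  flow+switching≤3k+2 = +-mono-≤ (≤-reflexive (trans flow-unitSchedule (flow-staggered k)))
                                 (variation-interval-≤ (suc (double k)) (staggeredLoad-interval k))

  k≤flow+switching : k ≤ flow + switching
  k≤flow+switching = begin
    k                     ≤⟨ m≤m+n k k ⟩
    k + k                 ≡⟨ double≡k+k k ⟨
    double k              ≡⟨ *-identityʳ (double k) ⟨
    double k * 1          ≤⟨ work≤flow ⟩
    flow                  ≤⟨ m≤m+n flow switching ⟩
    flow + switching      ∎
    where open ≤-Reasoning

  afS≡arrivals : ∀ t → afS t ≡ arrivals k t
  afS≡arrivals t = sumFin-cong (double k) (λ j → interval-unique (unit-size j) (pulse-interval (arrival k j)) t)
    where
    unit-size : ∀ j → IntervalIndicator (arrival k j) (suc (arrival k j)) (λ t → bit (outstanding afP t j))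
    unit-size j = subst (λ d → IntervalIndicator (arrival k j) d (λ t → bit (outstanding afP t j)))
                        (+-comm (arrival k j) 1) (afP-interval j)

  6k≤greedyCost : 6 * k ≤ greedyFlow + greedySwitching
  6k≤greedyCost = begin
    6 * k                                 ≡⟨ solve 1 (λ k → con 6 :* k := (k :+ k) :* con 1 :+ k :* con 4) refl k ⟩
    (k + k) * 1 + k * 4                   ≡⟨ cong (λ n → n * 1 + k * 4) (double≡k+k k) ⟨
    double k * 1 + k * 4                  ≤⟨ +-mono-≤ (≤-reflexive (sym (sumTo-afS afHorizon ≤-refl))) 4k≤greedySwitching ⟩
    greedyFlow + greedySwitching          ∎
    where
    open ≤-Reasoning
    4k≤greedySwitching : k * 4 ≤ greedySwitching
    4k≤greedySwitching = begin
      k * 4                               ≤⟨ variation-arrivals-≥ k ⟩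
      variation (double k) (arrivals k)   ≡⟨ sumTo-cong (double k) (λ t → cong₂ ∣_-_∣ (afS≡arrivals (suc t)) (afS≡arrivals t)) ⟨
      variation (double k) afS            ≤⟨ variation-monoˡ-≤ afS (double≤lastArrival+2 k) ⟩
      greedySwitching                     ∎

module RationalArithmetic where

  open import Data.Rational renaming (_≤_ to _≤ℚ_)
  open import Data.Rational.Properties
  open import Data.Rational.Solver using (module +-*-Solver)
  open +-*-Solver
  import Data.Nat as ℕ
  import Data.Nat.Properties as ℕ
  import Data.Integer as ℤ
  import Data.Integer.Properties as ℤ
  import Data.Rational.Unnormalised as ℚᵘ
  import Data.Rational.Unnormalised.Properties as ℚᵘ
  import Data.Nat.Coprimality as Coprime
  open import Data.Integer using (+_)
  open import Data.Product using (Σ; _,_)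
  open import Relation.Binary.PropositionalEquality

  toℚ-mkℚ : ∀ n → toℚ n ≡ mkℚ (+ n) 0 (Coprime.sym (Coprime.1-coprimeTo n))
  toℚ-mkℚ n = normalize-coprime (Coprime.sym (Coprime.1-coprimeTo n))

  toℚ-+ : ∀ m n → toℚ (m ℕ.+ n) ≡ toℚ m + toℚ n
  toℚ-+ m n rewrite toℚ-mkℚ m | toℚ-mkℚ n | ℤ.*-identityʳ (+ m) | ℤ.*-identityʳ (+ n) = refl

  toℚ-* : ∀ m n → toℚ (m ℕ.* n) ≡ toℚ m * toℚ n
  toℚ-* m n rewrite toℚ-mkℚ m | toℚ-mkℚ n | sym (ℤ.pos-* m n) = refl

  toℚ-mono-≤ : ∀ {m n} → m ℕ.≤ n → toℚ m ≤ℚ toℚ n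
  toℚ-mono-≤ {m} {n} m≤n rewrite toℚ-mkℚ m | toℚ-mkℚ n =
    *≤* (subst₂ ℤ._≤_ (sym (ℤ.*-identityʳ (+ m))) (sym (ℤ.*-identityʳ (+ n))) (ℤ.+≤+ m≤n))

  toℚ-mono-< : ∀ {m n} → m ℕ.< n → toℚ m < toℚ n
  toℚ-mono-< {m} {n} m<n rewrite toℚ-mkℚ m | toℚ-mkℚ n =
    *<* (subst₂ ℤ._<_ (sym (ℤ.*-identityʳ (+ m))) (sym (ℤ.*-identityʳ (+ n))) (ℤ.+<+ m<n))

  toℚ-nonNeg : ∀ n → NonNegative (toℚ n)
  toℚ-nonNeg n = nonNegative (toℚ-mono-≤ (ℕ.z≤n {n}))

  toℚ-2*-cost : ∀ α F V → toℚ (2 ℕ.* F) + α * toℚ (2 ℕ.* V) ≡ toℚ 2 * (toℚ F + α * toℚ V)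
  toℚ-2*-cost α F V rewrite toℚ-* 2 F | toℚ-* 2 V =
    solve 4 (λ t α f v → t :* f :+ α :* (t :* v) := t :* (f :+ α :* v)) refl (toℚ 2) α (toℚ F) (toℚ V)

  toℚ-cost-at-1 : ∀ F V → toℚ F + 1ℚ * toℚ V ≡ toℚ (F ℕ.+ V)
  toℚ-cost-at-1 F V = trans (cong (_+_ (toℚ F)) (*-identityˡ (toℚ V))) (sym (toℚ-+ F V))

  -- The hypotheses are the cases α = 0 and α = 1 of the conclusion, which is linear in α.
  interpolate-≤ : ∀ {a b c d α} → a ℕ.≤ b → a ℕ.+ c ℕ.≤ b ℕ.+ d → 0ℚ ≤ℚ α → α ≤ℚ 1ℚ →
                  toℚ a + α * toℚ c ≤ℚ toℚ b + α * toℚ d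
  interpolate-≤ {a} {b} {c} {d} {α} a≤b a+c≤b+d 0≤α α≤1 = begin
    toℚ a + α * toℚ c                     ≤⟨ +-monoʳ-≤ (toℚ a) (*-monoˡ-≤-nonNeg α {{nonNegative 0≤α}} (toℚ-mono-≤ c≤d+k)) ⟩
    toℚ a + α * toℚ (d ℕ.+ k)             ≡⟨ cong (λ x → toℚ a + α * x) (toℚ-+ d k) ⟩
    toℚ a + α * (toℚ d + toℚ k)           ≡⟨ solve 4 (λ a α d k → a :+ α :* (d :+ k) := (a :+ α :* d) :+ α :* k) refl (toℚ a) α (toℚ d) (toℚ k) ⟩
    (toℚ a + α * toℚ d) + α * toℚ k       ≤⟨ +-monoʳ-≤ (toℚ a + α * toℚ d) αk≤k ⟩
    (toℚ a + α * toℚ d) + toℚ k           ≡⟨ solve 3 (λ a αd k → (a :+ αd) :+ k := (a :+ k) :+ αd) refl (toℚ a) (α * toℚ d) (toℚ k) ⟩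
    (toℚ a + toℚ k) + α * toℚ d           ≡⟨ cong (_+ α * toℚ d) (trans (sym (toℚ-+ a k)) (cong toℚ (ℕ.m+[n∸m]≡n a≤b))) ⟩
    toℚ b + α * toℚ d                     ∎
    where
    open ≤-Reasoning
    k : ℕ.ℕ
    k = b ℕ.∸ a
    c≤d+k : c ℕ.≤ d ℕ.+ k
    c≤d+k = ℕ.+-cancelˡ-≤ a c (d ℕ.+ k) (ℕ.≤-trans a+c≤b+d (ℕ.≤-reflexive
      (trans (cong (ℕ._+ d) (sym (ℕ.m+[n∸m]≡n a≤b))) (trans (ℕ.+-assoc a k d) (cong (a ℕ.+_) (ℕ.+-comm k d))))))
    αk≤k : α * toℚ k ≤ℚ toℚ k
    αk≤k = ≤-trans (*-monoʳ-≤-nonNeg (toℚ k) {{toℚ-nonNeg k}} α≤1) (≤-reflexive (*-identityˡ (toℚ k)))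

  archimedean : ∀ ε → 0ℚ < ε → ∀ q → Σ ℕ.ℕ (λ n → toℚ q < ε * toℚ n)
  archimedean (mkℚ (+ 0) _ _)           (*<* (ℤ.+<+ ())) q
  archimedean (mkℚ ℤ.-[1+ _ ] _ _)      (*<* ()) q
  archimedean ε@(mkℚ (+ ℕ.suc p) d _) _ q = ℕ.suc q ℕ.* ℕ.suc d , (begin-strict
    toℚ q                                          <⟨ toℚ-mono-< (ℕ.n<1+n q) ⟩
    toℚ (ℕ.suc q)                                  ≡⟨ *-identityʳ (toℚ (ℕ.suc q)) ⟨
    toℚ (ℕ.suc q) * 1ℚ                             ≤⟨ *-monoˡ-≤-nonNeg (toℚ (ℕ.suc q)) {{toℚ-nonNeg (ℕ.suc q)}} 1≤ε[d+1] ⟩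
    toℚ (ℕ.suc q) * (ε * toℚ (ℕ.suc d))            ≡⟨ solve 3 (λ x e y → x :* (e :* y) := e :* (x :* y)) refl (toℚ (ℕ.suc q)) ε (toℚ (ℕ.suc d)) ⟩
    ε * (toℚ (ℕ.suc q) * toℚ (ℕ.suc d))            ≡⟨ cong (ε *_) (toℚ-* (ℕ.suc q) (ℕ.suc d)) ⟨
    ε * toℚ (ℕ.suc q ℕ.* ℕ.suc d)                  ∎)
    where
    open ≤-Reasoning
    -- d + 1 is the denominator of ε, so ε (d + 1) is its numerator p + 1.
    1≤ε[d+1] : 1ℚ ≤ℚ ε * toℚ (ℕ.suc d)
    1≤ε[d+1] = toℚᵘ-cancel-≤ (ℚᵘ.≤-respʳ-≃ (ℚᵘ.≃-sym (toℚᵘ-homo-* ε (toℚ (ℕ.suc d)))) in-ℚᵘ)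
      where
      in-ℚᵘ : toℚᵘ 1ℚ ℚᵘ.≤ toℚᵘ ε ℚᵘ.* toℚᵘ (toℚ (ℕ.suc d))
      in-ℚᵘ rewrite toℚ-mkℚ (ℕ.suc d) = ℚᵘ.*≤* (subst₂ ℤ._≤_ (sym (ℤ.*-identityˡ _)) (sym (ℤ.*-identityʳ _))
        (ℤ.+≤+ (ℕ.≤-trans (ℕ.≤-reflexive (ℕ.*-identityʳ (ℕ.suc d))) (ℕ.m≤n*m (ℕ.suc d) (ℕ.suc p)))))

  ratio-gap : ∀ {ε k X Y} → 0ℚ < ε → toℚ 4 < ε * toℚ k → k ℕ.≤ X → X ℕ.≤ 3 ℕ.* k ℕ.+ 2 → 6 ℕ.* k ℕ.≤ Y →
              (toℚ 2 - ε) * toℚ X < toℚ Y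
  ratio-gap {ε} {k} {X} {Y} 0<ε 4<εk k≤X X≤3k+2 6k≤Y = begin-strict
    (toℚ 2 - ε) * toℚ X                        ≡⟨ solve 3 (λ t e x → (t :- e) :* x := t :* x :+ (:- (e :* x))) refl (toℚ 2) ε (toℚ X) ⟩
    toℚ 2 * toℚ X + - (ε * toℚ X)              ≤⟨ +-monoˡ-≤ (- (ε * toℚ X)) 2X≤6k+4 ⟩
    (toℚ (6 ℕ.* k) + toℚ 4) + - (ε * toℚ X)    <⟨ +-monoʳ-< (toℚ (6 ℕ.* k) + toℚ 4) (neg-antimono-< 4<εX) ⟩
    (toℚ (6 ℕ.* k) + toℚ 4) + - toℚ 4          ≡⟨ solve 2 (λ x y → (x :+ y) :+ (:- y) := x) refl (toℚ (6 ℕ.* k)) (toℚ 4) ⟩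
    toℚ (6 ℕ.* k)                              ≤⟨ toℚ-mono-≤ 6k≤Y ⟩
    toℚ Y                                      ∎
    where
    open ≤-Reasoning
    2X≤6k+4 : toℚ 2 * toℚ X ≤ℚ toℚ (6 ℕ.* k) + toℚ 4
    2X≤6k+4 = begin
      toℚ 2 * toℚ X                  ≡⟨ toℚ-* 2 X ⟨
      toℚ (2 ℕ.* X)                  ≤⟨ toℚ-mono-≤ (ℕ.≤-trans (ℕ.*-monoʳ-≤ 2 X≤3k+2) (ℕ.≤-reflexive 2[3k+2]≡6k+4)) ⟩
      toℚ (6 ℕ.* k ℕ.+ 4)            ≡⟨ toℚ-+ (6 ℕ.* k) 4 ⟩
      toℚ (6 ℕ.* k) + toℚ 4          ∎
      where
      2[3k+2]≡6k+4 : 2 ℕ.* (3 ℕ.* k ℕ.+ 2) ≡ 6 ℕ.* k ℕ.+ 4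
      2[3k+2]≡6k+4 = trans (ℕ.*-distribˡ-+ 2 (3 ℕ.* k) 2) (cong (ℕ._+ 4) (sym (ℕ.*-assoc 2 3 k)))
    4<εX : toℚ 4 < ε * toℚ X
    4<εX = <-≤-trans 4<εk (*-monoˡ-≤-nonNeg ε {{pos⇒nonNeg ε {{positive 0<ε}}}} (toℚ-mono-≤ k≤X))

open import Data.Product using (Σ; _×_; _,_)
open import Data.Rational using (ℚ; 0ℚ; 1ℚ; _-_; _*_; _<_) renaming (_≤_ to _≤ℚ_)

greedy-2-competitive : (α : ℚ) → 0ℚ ≤ℚ α → α ≤ℚ 1ℚ →
  (m : ℕ) (a : Fin m → ℕ) (w : ℕ) → 1 ≤ w → (∀ j → 1 ≤ a j) → (S : Model.Schedule m a w) →
  Model.costAf m a w α ≤ℚ toℚ 2 * Model.cost m a w α S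
greedy-2-competitive α 0≤α α≤1 m a w 1≤w 1≤a S = begin
  Model.costAf m a w α                                ≤⟨ interpolate-≤ greedyFlow≤2flow greedyCost≤2cost 0≤α α≤1 ⟩
  toℚ (2 ℕ.* flow) + α * toℚ (2 ℕ.* switching)        ≡⟨ toℚ-2*-cost α flow switching ⟩
  toℚ 2 * Model.cost m a w α S                        ∎
  where
  import Data.Nat as ℕ
  open import Data.Rational using (_+_)
  open import Data.Rational.Properties using (module ≤-Reasoning)
  open ≤-Reasoning
  open RationalArithmetic
  open FeasibleSchedule m a w 1≤w 1≤a S

staggered-ratio : ∀ ε k → 0ℚ < ε → toℚ 4 < ε * toℚ k →
  (toℚ 2 - ε) * Model.cost (Staggered.double k) (Staggered.arrival k) 1 1ℚ (StaggeredCosts.unitSchedule k)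
    < Model.costAf (Staggered.double k) (Staggered.arrival k) 1 1ℚ
staggered-ratio ε k 0<ε 4<εk = begin-strict
  (toℚ 2 - ε) * (toℚ flow + 1ℚ * toℚ switching)       ≡⟨ cong ((toℚ 2 - ε) *_) (toℚ-cost-at-1 flow switching) ⟩
  (toℚ 2 - ε) * toℚ (flow ℕ.+ switching)              <⟨ ratio-gap 0<ε 4<εk k≤flow+switching flow+switching≤3k+2 6k≤greedyCost ⟩
  toℚ (greedyFlow ℕ.+ greedySwitching)                ≡⟨ toℚ-cost-at-1 greedyFlow greedySwitching ⟨
  toℚ greedyFlow + 1ℚ * toℚ greedySwitching           ∎
  where
  import Data.Nat as ℕ
  open import Data.Rational using (_+_)
  open import Data.Rational.Properties using (module ≤-Reasoning)
  open import Relation.Binary.PropositionalEquality using (cong)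
  open ≤-Reasoning
  open RationalArithmetic
  open StaggeredCosts k

lemma1 : ((α : ℚ) → 0ℚ < α → α ≤ℚ 1ℚ →
    (m : ℕ) (a : Fin m → ℕ) (w : ℕ) → 1 ≤ w → (∀ j → 1 ≤ a j) →
    (S : Model.Schedule m a w) →
    Model.costAf m a w α ≤ℚ (toℚ 2 * Model.cost m a w α S))
    × ((ε : ℚ) → 0ℚ < ε →
    Σ ℚ (λ α → (0ℚ < α) × (α ≤ℚ 1ℚ) ×
    Σ ℕ (λ m → Σ (Fin m → ℕ) (λ a → Σ ℕ (λ w → (1 ≤ w) × (∀ j → 1 ≤ a j) ×
    Σ (Model.Schedule m a w) (λ S →
    ((toℚ 2 - ε) * Model.cost m a w α S) < Model.costAf m a w α))))))
lemma1 = (λ α 0<α → greedy-2-competitive α (<⇒≤ 0<α))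
       , λ ε 0<ε → let (k , 4<εk) = archimedean ε 0<ε 4 in
           1ℚ , toℚ-mono-< {0} {1} (s≤s z≤n) , ≤-refl , double k , arrival k , 1 , s≤s z≤n , 1≤arrival k ,
           unitSchedule k , staggered-ratio ε k 0<ε 4<εk
  where
  open import Data.Nat using (s≤s; z≤n)
  open import Data.Rational.Properties using (<⇒≤; ≤-refl)
  open RationalArithmetic using (archimedean; toℚ-mono-<)
  open Staggered using (double; arrival; 1≤arrival)
  open StaggeredCosts using (unitSchedule)
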